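{- Let $\mathcal{G}$ be any game structure and $\varphi$ any HyperATL* formula. If $\mathcal{G} \models [\forall \pi. \langle\langle A \rangle\rangle \pi'.]\, \varphi$ then $\mathcal{G} \models \forall \pi. \langle\langle A \rangle\rangle \pi'. \varphi$.
   Context: HyperATL* is evaluated over concurrent game structures. $\langle\langle A \rangle\rangle \pi.\varphi$ states that the agents in $A$ have a joint strategy (a function from finite state histories to moves) such that every outcome bound to $\pi$ satisfies $\varphi$; $\forall \pi$ is $\langle\langle \emptyset \rangle\rangle \pi$. In $\forall \pi.\langle\langle A \rangle\rangle \pi'.\varphi$ the path $\pi$ is fixed first and then the strategy for $A$ is chosen. The bracketed form $[\langle\langle A_1 \rangle\rangle \pi_1.\cdots\langle\langle A_k \rangle\rangle \pi_k.]\,\varphi$ resolves all $k$ paths in one game played on $k$ parallel copies of the structure progressing simultaneously: strategies are $k$-strategies mapping finite histories of tuples of states $(S^k)^+$ to moves, so agents may observe the current state of all copies, and all outcomes of this joint game must satisfy $\varphi$. -}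

module Defs where

open import Data.Nat using (ℕ; zero; suc; _<_)
open import Data.Nat.Properties using (_≟_)
open import Data.Fin using (Fin; zero; suc)
open import Data.Fin.Subset using (Subset; _∈_; ⊥)
open import Data.Bool using (Bool; true)
open import Data.Vec using (Vec; []; _∷_; tabulate)
open import Data.List using (List; map; upTo)
open import Data.List.NonEmpty using (List⁺; _∷_)
open import Data.Product using (Σ; _×_; _,_)
open import Relation.Binary.PropositionalEquality using (_≡_)
open import Relation.Nullary using (¬_; yes; no)

Var : Set
Var = ℕ

record CGS (nS nA nM : ℕ) (AP : Set) : Set where
  field
    s₀ : Fin nS
    δ  : Fin nS → (Fin nA → Fin nM) → Fin nS
    L  : Fin nS → AP → Bool

-- HyperATL* formulas.
--   ⟪ A ⟫ π ∙ φ              : strategy quantifier  ⟨⟨A⟩⟩π.φ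
--   [ qs ]∙ φ                 : bracketed form [⟨⟨A₁⟩⟩π₁ … ⟨⟨A_k⟩⟩π_k.] φ
data Formula (nA : ℕ) (AP : Set) : Set where
  atom  : AP → Var → Formula nA AP
  ¬'_   : Formula nA AP → Formula nA AP
  _∧'_  : Formula nA AP → Formula nA AP → Formula nA AP
  X'_   : Formula nA AP → Formula nA AP
  _U'_  : Formula nA AP → Formula nA AP → Formula nA AP
  ⟪_⟫_∙_ : Subset nA → Var → Formula nA AP → Formula nA AP
  [_]∙_ : ∀ {k} → Vec (Subset nA × Var) k → Formula nA AP → Formula nA AP

∀'_∙_ : ∀ {nA AP} → Var → Formula nA AP → Formula nA AP
∀' π ∙ φ = ⟪ ⊥ ⟫ π ∙ φ

module Semantics {nS nA nM : ℕ} {AP : Set} (G : CGS nS nA nM AP) where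
  open CGS G

  State : Set
  State = Fin nS

  Path : Set
  Path = ℕ → State

  -- path assignment: values of variables plus the current path ε
  record Assign : Set where
    constructor mkAssign
    field
      val : Var → Path
      cur : Path
  open Assign public

  shiftPath : ℕ → Path → Path
  shiftPath i p j = p (i Data.Nat.+ j)

  shift : ℕ → Assign → Assign
  shift i Π = mkAssign (λ x → shiftPath i (val Π x)) (shiftPath i (cur Π))

  bind : Var → Path → Assign → Assign
  bind x p Π = mkAssign (λ y → upd y (x ≟ y)) p
    where
    upd : ∀ y → Relation.Nullary.Dec (x ≡ y) → Path
    upd y (yes _) = p
    upd y (no _)  = val Π y

  bindAll : ∀ {k} → Vec (Subset nA × Var) k → (Fin k → Path) → Assign → Assign
  bindAll []             ps Π = Π
  bindAll ((_ , x) ∷ qs) ps Π = bindAll qs (λ j → ps (suc j)) (bind x (ps zero) Π)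

  hist : ∀ {B : Set} → (ℕ → B) → ℕ → List⁺ B
  hist p i = p 0 ∷ map (λ j → p (suc j)) (upTo i)

  MoveVec : Set
  MoveVec = Fin nA → Fin nM

  Strategy : Set
  Strategy = List⁺ State → MoveVec

  Out : Subset nA → State → Strategy → Path → Set
  Out A s f p = (p 0 ≡ s) × (∀ i → Σ MoveVec λ σ →
                  (∀ a → a ∈ A → σ a ≡ f (hist p i) a) × (p (suc i) ≡ δ (p i) σ))

  KStrategy : ℕ → Set
  KStrategy k = Fin k → List⁺ (Vec State k) → MoveVec

  OutK : ∀ {k} → Vec (Subset nA × Var) k → State → KStrategy k → (Fin k → Path) → Set
  OutK {k} qs s f ps = (∀ j → ps j 0 ≡ s) ×
    (∀ i j → Σ MoveVec λ σ →
       (∀ a → a ∈ Data.Product.proj₁ (Data.Vec.lookup qs j) →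
          σ a ≡ f j (hist (λ t → tabulate (λ j' → ps j' t)) i) a)
       × (ps j (suc i) ≡ δ (ps j i) σ))

  infix 4 _⊨_
  _⊨_ : Assign → Formula nA AP → Set
  Π ⊨ atom a x   = L (val Π x 0) a ≡ true
  Π ⊨ ¬' φ       = ¬ (Π ⊨ φ)
  Π ⊨ (φ ∧' ψ)   = (Π ⊨ φ) × (Π ⊨ ψ)
  Π ⊨ X' φ       = shift 1 Π ⊨ φ
  Π ⊨ (φ U' ψ)   = Σ ℕ λ n → (shift n Π ⊨ ψ) × (∀ m → m < n → shift m Π ⊨ φ)
  Π ⊨ ⟪ A ⟫ x ∙ φ = Σ Strategy λ f → ∀ p → Out A (cur Π 0) f p → bind x p Π ⊨ φ
  Π ⊨ [ qs ]∙ φ  = Σ (KStrategy _) λ f → ∀ ps → OutK qs (cur Π 0) f ps → bindAll qs ps Π ⊨ φ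

  Π₀ : Assign
  Π₀ = mkAssign (λ _ _ → s₀) (λ _ → s₀)

_⊨ᴳ_ : ∀ {nS nA nM AP} → CGS nS nA nM AP → Formula nA AP → Set
G ⊨ᴳ φ = Semantics._⊨_ G (Semantics.Π₀ G) φ

{-# OPTIONS --safe #-}
-- Once the path π is fixed, A can play the π'-copy of the joint two-copy game on
-- its own: its strategy pairs its own history with the known prefix of π and
-- consults the joint strategy on that pair of histories. Every outcome π' of this
-- strategy then forms, together with π, an outcome of the joint game.
module Submission where

open import Defs
open import Data.Nat using (ℕ; zero; suc)
open import Data.Fin using (zero; suc)
open import Data.Fin.Subset using (Subset; ⊥; _∈_)
open import Data.Fin.Subset.Properties using (∉⊥)
open import Data.Vec using (Vec; []; _∷_; lookup)
open import Data.List using (List; []; _∷_; map; applyUpTo; upTo)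
open import Data.List.Properties using (map-applyUpTo)
open import Data.List.NonEmpty using (List⁺; _∷_)
open import Data.Product using (Σ; _×_; _,_; proj₁)
open import Data.Empty using (⊥-elim)
open import Function using (_∘_)
open import Relation.Binary.PropositionalEquality using (_≡_; refl; cong; trans)
open Relation.Binary.PropositionalEquality.≡-Reasoning

module _ {A B C : Set} (c : A → B → C) where

  zipWithStream : (ℕ → A) → List B → List C
  zipWithStream p []       = []
  zipWithStream p (y ∷ ys) = c (p 0) y ∷ zipWithStream (p ∘ suc) ys

  zipWithStream⁺ : (ℕ → A) → List⁺ B → List⁺ C
  zipWithStream⁺ p (y ∷ ys) = c (p 0) y ∷ zipWithStream (p ∘ suc) ys

  zipWithStream-applyUpTo : ∀ (p : ℕ → A) (q : ℕ → B) n →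
    zipWithStream p (applyUpTo q n) ≡ applyUpTo (λ k → c (p k) (q k)) n
  zipWithStream-applyUpTo p q zero    = refl
  zipWithStream-applyUpTo p q (suc n) =
    cong (c (p 0) (q 0) ∷_) (zipWithStream-applyUpTo (p ∘ suc) (q ∘ suc) n)

module _ {nS nA nM : ℕ} {AP : Set} (G : CGS nS nA nM AP) where
  open Semantics G
  open CGS G

  zipWithStream⁺-hist : ∀ {A B C : Set} (c : A → B → C) (p : ℕ → A) (q : ℕ → B) i →
    zipWithStream⁺ c p (hist q i) ≡ hist (λ t → c (p t) (q t)) i
  zipWithStream⁺-hist c p q i = cong (c (p 0) (q 0) ∷_) (begin
    zipWithStream c (p ∘ suc) (map (q ∘ suc) (upTo i))
      ≡⟨ cong (zipWithStream c (p ∘ suc)) (map-applyUpTo _ (q ∘ suc) i) ⟩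
    zipWithStream c (p ∘ suc) (applyUpTo (q ∘ suc) i)
      ≡⟨ zipWithStream-applyUpTo c (p ∘ suc) (q ∘ suc) i ⟩
    applyUpTo (λ k → c (p (suc k)) (q (suc k))) i
      ≡⟨ map-applyUpTo _ (λ k → c (p (suc k)) (q (suc k))) i ⟨
    map (λ k → c (p (suc k)) (q (suc k))) (upTo i) ∎)

  pair : State → State → Vec State 2
  pair s t = s ∷ t ∷ []

  -- Coalition ∅ is unconstrained, so any strategy serves for ∀π; this one only
  -- witnesses that Strategy is inhabited.
  diagonal : KStrategy 2 → Strategy
  diagonal f h = f zero (Data.List.NonEmpty.map (λ s → pair s s) h)

  alongside : KStrategy 2 → Path → Strategy
  alongside f p h = f (suc zero) (zipWithStream⁺ pair p h)

  OutK-alongside : ∀ {s g p q} (f : KStrategy 2) (A : Subset nA) (π π' : Var) →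
    Out ⊥ s g p → Out A (p 0) (alongside f p) q →
    OutK ((⊥ , π) ∷ (A , π') ∷ []) s f (lookup (p ∷ q ∷ []))
  OutK-alongside {s} {p = p} {q = q} f A π π' (p₀ , pSteps) (q₀ , qSteps) = start , step
    where
    start : ∀ j → lookup (p ∷ q ∷ []) j 0 ≡ s
    start zero       = p₀
    start (suc zero) = trans q₀ p₀

    step : ∀ i j → Σ MoveVec λ σ →
      (∀ a → a ∈ proj₁ (lookup ((⊥ , π) ∷ (A , π') ∷ []) j) →
         σ a ≡ f j (hist (λ t → pair (p t) (q t)) i) a)
      × (lookup (p ∷ q ∷ []) j (suc i) ≡ δ (lookup (p ∷ q ∷ []) j i) σ)
    step i zero with pSteps i
    ... | σ , _ , next = σ , (λ a a∈⊥ → ⊥-elim (∉⊥ a∈⊥)) , next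
    step i (suc zero) with qSteps i
    ... | σ , follows , next =
      σ , (λ a a∈A → trans (follows a a∈A)
                       (cong (λ h → f (suc zero) h a) (zipWithStream⁺-hist pair p q i)))
        , next

lemma4p3 : ∀ {nS nA nM : ℕ} {AP : Set} (G : CGS nS nA nM AP) (A : Subset nA)
             (π π' : Var) (φ : Formula nA AP) →
             G ⊨ᴳ ([ (⊥ , π) ∷ (A , π') ∷ [] ]∙ φ) →
             G ⊨ᴳ (∀' π ∙ (⟪ A ⟫ π' ∙ φ))
lemma4p3 G A π π' φ (f , joint) =
  diagonal G f , λ p p-out →
    alongside G f p , λ q q-out →
      joint (lookup (p ∷ q ∷ [])) (OutK-alongside G {g = diagonal G f} f A π π' p-out q-out)
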